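{- There are absolute constants $c>0$ and $n_0$ such that for every $n\ge n_0$ and every v-tree $T$ on the variables $X_n=\{x_{ij}\mid i,j\in[n]\}$, there is a node $t$ of $T$ with $\mathsf{cc}(\mathrm{PERM}_n, (Y, Z)) \ge cn$, where $Y=\mathsf{var}(T_t)$ and $Z= X_n\setminus Y$; that is, $\mathsf{cc}(\mathrm{PERM}_n,(Y,Z))=\Omega(n)$.
   Context: $\mathrm{PERM}_n$ is the Boolean function on $X_n=\{x_{ij}\mid i,j\in[n]\}$, viewed as an $n\times n$ matrix, that evaluates to $1$ exactly on permutation matrices (every row and every column contains exactly one $1$). A v-tree for a finite variable set $X$ is a full binary rooted tree whose leaves are in bijection with $X$; for a node $t$, $T_t$ is the subtree rooted at $t$ and $\mathsf{var}(T_t)$ the set of variables labelling its leaves. For a partition $(Y,Z)$ of the variables, a rectangle cover of $f$ of size $s$ respecting $(Y,Z)$ is a representation $f=\bigvee_{i=1}^s r_1^i(Y)\land r_2^i(Z)$ with Boolean functions $r_1^i$ on $Y$ and $r_2^i$ on $Z$; $\mathsf{cc}(f,(Y,Z))$ is $\log_2$ of the minimum size of such a cover. -}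

module Defs where

open import Data.Nat using (ℕ; zero; suc; _+_; _≡ᵇ_)
open import Data.Bool using (Bool; true; false; _∧_; _∨_; not; if_then_else_)
open import Data.Fin using (Fin; zero; suc)
import Data.Fin.Properties as FinP
open import Data.Product using (_×_; _,_; proj₁; proj₂)
open import Data.Product.Properties using (≡-dec)
open import Relation.Nullary.Decidable using (⌊_⌋)
open import Relation.Binary.PropositionalEquality using (_≡_)

-- Variables x_ij of X_n, i,j ∈ [n] (indexed by Fin n)
Var : ℕ → Set
Var n = Fin n × Fin n

Assignment : ℕ → Set
Assignment n = Var n → Bool

BoolFun : ℕ → Set
BoolFun n = Assignment n → Bool

andFin : ∀ {k} → (Fin k → Bool) → Bool
andFin {zero}  f = true
andFin {suc k} f = f zero ∧ andFin (λ i → f (suc i))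

orFin : ∀ {k} → (Fin k → Bool) → Bool
orFin {zero}  f = false
orFin {suc k} f = f zero ∨ orFin (λ i → f (suc i))

countTrue : ∀ {k} → (Fin k → Bool) → ℕ
countTrue {zero}  f = 0
countTrue {suc k} f = (if f zero then 1 else 0) + countTrue (λ i → f (suc i))

PERM : (n : ℕ) → BoolFun n
PERM n a = andFin (λ i → countTrue (λ j → a (i , j)) ≡ᵇ 1)
         ∧ andFin (λ j → countTrue (λ i → a (i , j)) ≡ᵇ 1)

data Tree (n : ℕ) : Set where
  leaf : Var n → Tree n
  node : Tree n → Tree n → Tree n

_≟v_ : ∀ {n} → (u v : Var n) → _
_≟v_ = ≡-dec FinP._≟_ FinP._≟_

occ : ∀ {n} → Var n → Tree n → ℕ
occ v (leaf u)   = if ⌊ v ≟v u ⌋ then 1 else 0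
occ v (node l r) = occ v l + occ v r

-- A v-tree on X_n: leaves in bijection with X_n,
-- i.e. every variable labels exactly one leaf
record VTree (n : ℕ) : Set where
  field
    tree : Tree n
    bij  : ∀ (v : Var n) → occ v tree ≡ 1
open VTree public

-- s is (the subtree rooted at) a node of t
data _≼_ {n : ℕ} : Tree n → Tree n → Set where
  here  : ∀ {t} → t ≼ t
  left  : ∀ {s l r} → s ≼ l → s ≼ node l r
  right : ∀ {s l r} → s ≼ r → s ≼ node l r

var : ∀ {n} → Tree n → Var n → Bool
var t v = not (occ v t ≡ᵇ 0)

-- g is a Boolean function on the variables Y only
DependsOnly : ∀ {n} → (Var n → Bool) → BoolFun n → Set
DependsOnly {n} Y g =
  ∀ (a b : Assignment n) → (∀ v → Y v ≡ true → a v ≡ b v) → g a ≡ g b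

-- A rectangle cover of f of size s respecting (Y, X_n \ Y)
record RectCover {n : ℕ} (f : BoolFun n) (Y : Var n → Bool) (s : ℕ) : Set where
  field
    r₁ : Fin s → BoolFun n
    r₂ : Fin s → BoolFun n
    r₁-on-Y : ∀ i → DependsOnly Y (r₁ i)
    r₂-on-Z : ∀ i → DependsOnly (λ v → not (Y v)) (r₂ i)
    covers  : ∀ (a : Assignment n) → f a ≡ orFin (λ i → r₁ i a ∧ r₂ i a)

module Submission where

-- Let k = ⌊n/3⌋ and call the diagonal variable x_ii inside a node t when it
-- labels a leaf of T_t. The number of inside diagonal variables is n at the
-- root, subadditive at inner nodes and at most 1 at leaves, so descending from
-- the root we reach a node t with between k and 2k of them. Hence there are k
-- diagonal indices a_m with x_{a_m a_m} ∈ Y = var(T_t) and k indices b_m with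
-- x_{b_m b_m} ∉ Y. For x ∈ {0,1}^k let σ_x swap a_m and b_m exactly when
-- x_m = 1. The permutation matrices of the σ_x form a fooling set for (Y, Z):
-- if x_m = 0 and y_m = 1, the matrix agreeing with σ_x on Y and with σ_y on Z
-- has either an empty row b_m or two ones in column a_m. A rectangle of a
-- cover cannot contain two members of a fooling set, so every cover has at
-- least 2^k ≥ 2^(n/4) rectangles once n ≥ 6: lemma8 holds with c = 1/4.

open import Defs
open import Data.Nat using (ℕ; _*_; _^_; _≤_; _<_)
open import Data.Product using (Σ; _×_)

open import Data.Bool using (Bool; true; false; _∧_; _∨_; not; if_then_else_)
open import Data.Bool.Properties using (∧-conicalˡ; ∧-conicalʳ; T-≡; if-float; not-injective)
open import Data.Fin using (Fin; zero; suc; combine; finToFun; funToFin)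
open import Data.Fin.Permutation
  using (Permutation′; _⟨$⟩ʳ_; _⟨$⟩ˡ_; _∘ₚ_; inverseˡ; inverseʳ; transpose) renaming (id to idₚ)
import Data.Fin.Permutation.Components as Components
open import Data.Fin.Properties using (_≟_; suc-injective; 0≢1+n; injective⇒≤; 2↔Bool; funToFin-finToFin)
open import Data.Nat using (zero; suc; pred; _+_; _≡ᵇ_; z≤n; s≤s; s≤s⁻¹; _≤?_)
open import Data.Nat.DivMod using (_/_; _%_; m≡m%n+[m/n]*n; m%n<n; m/n*n≤m; /-monoˡ-≤)
open import Data.Nat.Properties
  using (≤-refl; ≤-trans; ≤-reflexive; <⇒≤; ≰⇒>; m≤m+n; m≤n⇒m≤1+n; ≡ᵇ⇒≡;
         +-assoc; +-identityʳ; +-suc; +-mono-≤; +-monoˡ-≤; +-monoʳ-≤; +-cancelˡ-≤;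
         *-identityˡ; *-comm; *-suc; ^-monoʳ-≤; ^-monoˡ-≤; ^-*-assoc; module ≤-Reasoning)
open import Data.Product using (_,_; proj₁; proj₂)
open import Function using (_∘_; _⇔_; Equivalence; mk⇔; Injection; Inverse)
open import Function.Definitions using (Injective)
open import Function.Properties.Inverse using (↔⇒↣)
open import Relation.Nullary using (¬_; does; yes; no; contradiction)
open import Relation.Nullary.Decidable using (dec-true; dec-false; does-⇔)
open import Relation.Binary.PropositionalEquality

countTrue-cong : ∀ {k} {f g : Fin k → Bool} → (∀ i → f i ≡ g i) → countTrue f ≡ countTrue g
countTrue-cong {zero}  e = refl
countTrue-cong {suc k} e = cong₂ (λ b c → (if b then 1 else 0) + c) (e zero) (countTrue-cong (e ∘ suc))

countTrue-mono : ∀ {k} {f g : Fin k → Bool} → (∀ i → f i ≡ true → g i ≡ true) → countTrue f ≤ countTrue g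
countTrue-mono {zero} h = z≤n
countTrue-mono {suc k} {f} {g} h with f zero in fz | g zero in gz
... | true  | true  = s≤s (countTrue-mono (h ∘ suc))
... | true  | false = contradiction (trans (sym (h zero fz)) gz) λ ()
... | false | true  = m≤n⇒m≤1+n (countTrue-mono (h ∘ suc))
... | false | false = countTrue-mono (h ∘ suc)

countTrue-∨ : ∀ {k} (f g : Fin k → Bool) → countTrue (λ i → f i ∨ g i) ≤ countTrue f + countTrue g
countTrue-∨ {zero}  f g = z≤n
countTrue-∨ {suc k} f g with f zero | g zero
... | true  | true  = s≤s (≤-trans (countTrue-∨ (f ∘ suc) (g ∘ suc)) (+-monoʳ-≤ _ (m≤n⇒m≤1+n ≤-refl)))
... | true  | false = s≤s (countTrue-∨ (f ∘ suc) (g ∘ suc))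
... | false | true  = ≤-trans (s≤s (countTrue-∨ (f ∘ suc) (g ∘ suc))) (≤-reflexive (sym (+-suc _ _)))
... | false | false = countTrue-∨ (f ∘ suc) (g ∘ suc)

countTrue-all : ∀ {k} {f : Fin k → Bool} → (∀ i → f i ≡ true) → countTrue f ≡ k
countTrue-all {zero}  h = refl
countTrue-all {suc k} h rewrite h zero = cong suc (countTrue-all (h ∘ suc))

countTrue-none : ∀ {k} {f : Fin k → Bool} → (∀ i → f i ≡ false) → countTrue f ≡ 0
countTrue-none {zero}  h = refl
countTrue-none {suc k} h rewrite h zero = countTrue-none (h ∘ suc)

countTrue-compl : ∀ {k} (f : Fin k → Bool) → countTrue f + countTrue (not ∘ f) ≡ k
countTrue-compl {zero}  f = refl
countTrue-compl {suc k} f with f zero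
... | true  = cong suc (countTrue-compl (f ∘ suc))
... | false = trans (+-suc _ _) (cong suc (countTrue-compl (f ∘ suc)))

countTrue-nonzero : ∀ {k} {f : Fin k → Bool} i → f i ≡ true → countTrue f ≢ 0
countTrue-nonzero zero fi rewrite fi = λ ()
countTrue-nonzero {f = f} (suc i) fi with f zero
... | true  = λ ()
... | false = countTrue-nonzero i fi

countTrue-singleton : ∀ {k} (c : Fin k) → countTrue (λ j → does (c ≟ j)) ≡ 1
countTrue-singleton {suc k} zero    = cong suc (countTrue-none {k} (λ _ → refl))
countTrue-singleton {suc k} (suc c) = countTrue-singleton c

countTrue≡1-unique : ∀ {k} {f : Fin k → Bool} {i j} → countTrue f ≡ 1 → f i ≡ true → f j ≡ true → i ≡ j
countTrue≡1-unique {i = zero}  {zero}  e fi fj = refl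
countTrue≡1-unique {i = zero}  {suc j} e fi fj rewrite fi = contradiction (cong pred e) (countTrue-nonzero j fj)
countTrue≡1-unique {i = suc i} {zero}  e fi fj rewrite fj = contradiction (cong pred e) (countTrue-nonzero i fi)
countTrue≡1-unique {f = f} {suc i} {suc j} e fi fj with f zero
... | true  = contradiction (cong pred e) (countTrue-nonzero i fi)
... | false = cong suc (countTrue≡1-unique e fi fj)

andFin-intro : ∀ {k} {f : Fin k → Bool} → (∀ i → f i ≡ true) → andFin f ≡ true
andFin-intro {zero}  h = refl
andFin-intro {suc k} h rewrite h zero = andFin-intro (h ∘ suc)

andFin-elim : ∀ {k} {f : Fin k → Bool} → andFin f ≡ true → ∀ i → f i ≡ true
andFin-elim {suc k} {f} e zero    = ∧-conicalˡ (f zero) _ e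
andFin-elim {suc k} {f} e (suc i) = andFin-elim (∧-conicalʳ (f zero) _ e) i

orFin-intro : ∀ {k} {f : Fin k → Bool} i → f i ≡ true → orFin f ≡ true
orFin-intro {f = f} zero    fi rewrite fi = refl
orFin-intro {f = f} (suc i) fi with f zero
... | true  = refl
... | false = orFin-intro i fi

orFin-elim : ∀ {k} {f : Fin k → Bool} → orFin f ≡ true → Σ (Fin k) λ i → f i ≡ true
orFin-elim {suc k} {f} e with f zero in fz
... | true  = zero , fz
... | false = let (i , fi) = orFin-elim e in suc i , fi

record IsPermMatrix {n : ℕ} (M : Assignment n) : Set where
  field
    rows    : ∀ i → countTrue (λ j → M (i , j)) ≡ 1
    columns : ∀ j → countTrue (λ i → M (i , j)) ≡ 1

PERM-intro : ∀ {n} {M : Assignment n} → IsPermMatrix M → PERM n M ≡ true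
PERM-intro P = cong₂ _∧_ (andFin-intro (λ i → cong (_≡ᵇ 1) (IsPermMatrix.rows P i)))
                         (andFin-intro (λ j → cong (_≡ᵇ 1) (IsPermMatrix.columns P j)))

PERM-elim : ∀ {n} {M : Assignment n} → PERM n M ≡ true → IsPermMatrix M
PERM-elim accepted = record
  { rows    = λ i → count≡1 (andFin-elim (∧-conicalˡ _ _ accepted) i)
  ; columns = λ j → count≡1 (andFin-elim (∧-conicalʳ _ _ accepted) j)
  }
  where
  count≡1 : ∀ {c} → (c ≡ᵇ 1) ≡ true → c ≡ 1
  count≡1 {c} c≡ᵇ1 = ≡ᵇ⇒≡ c 1 (Equivalence.from T-≡ c≡ᵇ1)

-- For a measure on trees that is at most 1 at leaves and
-- subadditive at inner nodes, any tree of measure at least k ≥ 1 has a node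
-- whose measure lies between k and 2k: descend into a child of measure ≥ k
-- while the current node exceeds 2k.

module BalancedNode {n : ℕ} (μ : Tree n → ℕ)
                    (μ-leaf : ∀ u → μ (leaf u) ≤ 1)
                    (μ-node : ∀ l r → μ (node l r) ≤ μ l + μ r) where

  balanced-node : ∀ k → 1 ≤ k → (t : Tree n) → k ≤ μ t →
                  Σ (Tree n) λ s → s ≼ t × k ≤ μ s × μ s ≤ k + k
  balanced-node k 1≤k t k≤μt with μ t ≤? k + k
  ... | yes small = t , here , k≤μt , small
  balanced-node k 1≤k (leaf u) k≤μt | no big =
    contradiction (≤-trans (μ-leaf u) (≤-trans 1≤k (m≤m+n k k))) big
  balanced-node k 1≤k (node l r) k≤μt | no big with k ≤? μ l | k ≤? μ r
  ... | yes k≤μl | _ = let (s , s≼l , bounds) = balanced-node k 1≤k l k≤μl in s , left s≼l , bounds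
  ... | no _ | yes k≤μr = let (s , s≼r , bounds) = balanced-node k 1≤k r k≤μr in s , right s≼r , bounds
  ... | no μl<k | no μr<k =
    contradiction (≤-trans (μ-node l r) (+-mono-≤ (<⇒≤ (≰⇒> μl<k)) (<⇒≤ (≰⇒> μr<k)))) big

-- Diagonal variables below a node. Their number is the measure used to
-- choose the node t: it is n at the root of a v-tree, at most 1 at a leaf and
-- subadditive at inner nodes.

diagonal : ∀ {n} → (Var n → Bool) → Fin n → Bool
diagonal Y i = Y (i , i)

diagCount : ∀ {n} → Tree n → ℕ
diagCount t = countTrue (diagonal (var t))

var-node : ∀ {n} (l r : Tree n) v → var (node l r) v ≡ true → var l v ∨ var r v ≡ true
var-node l r v below with occ v l | occ v r
... | zero  | zero  = below
... | suc _ | _     = refl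
... | zero  | suc _ = refl

diagCount-leaf : ∀ {n} (u : Var n) → diagCount (leaf u) ≤ 1
diagCount-leaf (a , b) = ≤-trans (countTrue-mono diagonal-at-a) (≤-reflexive (countTrue-singleton a))
  where
  diagonal-at-a : ∀ i → var (leaf (a , b)) (i , i) ≡ true → does (a ≟ i) ≡ true
  diagonal-at-a i below with (i , i) ≟v (a , b)
  ... | yes refl = dec-true (i ≟ i) refl
  ... | no _     = contradiction below λ ()

diagCount-node : ∀ {n} (l r : Tree n) → diagCount (node l r) ≤ diagCount l + diagCount r
diagCount-node l r =
  ≤-trans (countTrue-mono (λ i → var-node l r (i , i))) (countTrue-∨ (diagonal (var l)) (diagonal (var r)))

diagCount-root : ∀ {n} (T : VTree n) → diagCount (tree T) ≡ n
diagCount-root T = countTrue-all (λ i → cong (λ o → not (o ≡ᵇ 0)) (bij T (i , i)))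

permMatrix : ∀ {n} → Permutation′ n → Assignment n
permMatrix σ (i , j) = does (σ ⟨$⟩ʳ i ≟ j)

-- Row i has its single 1 at σ i, column j at σ⁻¹ j.
permMatrix-isPerm : ∀ {n} (σ : Permutation′ n) → IsPermMatrix (permMatrix σ)
permMatrix-isPerm σ = record
  { rows    = λ i → countTrue-singleton (σ ⟨$⟩ʳ i)
  ; columns = λ j → trans (countTrue-cong (λ i → does-⇔ (preimage j i) (σ ⟨$⟩ʳ i ≟ j) (σ ⟨$⟩ˡ j ≟ i)))
                          (countTrue-singleton (σ ⟨$⟩ˡ j))
  }
  where
  preimage : ∀ j i → (σ ⟨$⟩ʳ i ≡ j) ⇔ (σ ⟨$⟩ˡ j ≡ i)
  preimage j i = mk⇔ (λ e → trans (cong (σ ⟨$⟩ˡ_) (sym e)) (inverseˡ σ))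
                     (λ e → trans (cong (σ ⟨$⟩ʳ_) (sym e)) (inverseʳ σ))

transpose-left : ∀ {n} (a b : Fin n) → Components.transpose a b a ≡ b
transpose-left a b rewrite dec-true (a ≟ a) refl = refl

transpose-right : ∀ {n} {a b : Fin n} → a ≢ b → Components.transpose a b b ≡ a
transpose-right {a = a} {b} a≢b rewrite dec-false (b ≟ a) (a≢b ∘ sym) | dec-true (b ≟ b) refl = refl

transpose-other : ∀ {n} {a b i : Fin n} → i ≢ a → i ≢ b → Components.transpose a b i ≡ i
transpose-other {a = a} {b} {i} i≢a i≢b rewrite dec-false (i ≟ a) i≢a | dec-false (i ≟ b) i≢b = refl

swapIf : ∀ {n} → Bool → Fin n → Fin n → Permutation′ n
swapIf false a b = idₚ
swapIf true  a b = transpose a b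

swapIf-left : ∀ {n} c (a b : Fin n) → swapIf c a b ⟨$⟩ʳ a ≡ (if c then b else a)
swapIf-left false a b = refl
swapIf-left true  a b = transpose-left a b

swapIf-right : ∀ {n} c {a b : Fin n} → a ≢ b → swapIf c a b ⟨$⟩ʳ b ≡ (if c then a else b)
swapIf-right false a≢b = refl
swapIf-right true  a≢b = transpose-right a≢b

swapIf-other : ∀ {n} c {a b i : Fin n} → i ≢ a → i ≢ b → swapIf c a b ⟨$⟩ʳ i ≡ i
swapIf-other false i≢a i≢b = refl
swapIf-other true  i≢a i≢b = transpose-other i≢a i≢b

record DisjointInjections {n k : ℕ} (a b : Fin k → Fin n) : Set where
  field
    a-injective : Injective _≡_ _≡_ a
    b-injective : Injective _≡_ _≡_ b
    apart       : ∀ m m' → a m ≢ b m'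

disjoint-tail : ∀ {n k} {a b : Fin (suc k) → Fin n} →
                DisjointInjections a b → DisjointInjections (a ∘ suc) (b ∘ suc)
disjoint-tail d = record { a-injective = suc-injective ∘ a-injective
                         ; b-injective = suc-injective ∘ b-injective
                         ; apart       = λ m m' → apart (suc m) (suc m') }
  where open DisjointInjections d

swaps : ∀ {n k} → (Fin k → Fin n) → (Fin k → Fin n) → (Fin k → Bool) → Permutation′ n
swaps {k = zero}  a b x = idₚ
swaps {k = suc k} a b x = swaps (a ∘ suc) (b ∘ suc) (x ∘ suc) ∘ₚ swapIf (x zero) (a zero) (b zero)

swaps-fix : ∀ {n k} (a b : Fin k → Fin n) x {i} → (∀ m → i ≢ a m) → (∀ m → i ≢ b m) → swaps a b x ⟨$⟩ʳ i ≡ i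
swaps-fix {k = zero}  a b x i∉a i∉b = refl
swaps-fix {k = suc k} a b x i∉a i∉b =
  trans (cong (swapIf (x zero) (a zero) (b zero) ⟨$⟩ʳ_) (swaps-fix (a ∘ suc) (b ∘ suc) (x ∘ suc) (i∉a ∘ suc) (i∉b ∘ suc)))
        (swapIf-other (x zero) (i∉a zero) (i∉b zero))

module _ {n k : ℕ} {a b : Fin (suc k) → Fin n} (d : DisjointInjections a b) where
  open DisjointInjections d

  head-fixes-left : ∀ c m → swapIf c (a zero) (b zero) ⟨$⟩ʳ a (suc m) ≡ a (suc m)
  head-fixes-left c m = swapIf-other c (0≢1+n ∘ sym ∘ a-injective) (apart (suc m) zero)

  head-fixes-right : ∀ c m → swapIf c (a zero) (b zero) ⟨$⟩ʳ b (suc m) ≡ b (suc m)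
  head-fixes-right c m = swapIf-other c (apart zero (suc m) ∘ sym) (0≢1+n ∘ sym ∘ b-injective)

  tail-fixes-left : ∀ x → swaps (a ∘ suc) (b ∘ suc) x ⟨$⟩ʳ a zero ≡ a zero
  tail-fixes-left x = swaps-fix (a ∘ suc) (b ∘ suc) x (λ m → 0≢1+n ∘ a-injective) (λ m → apart zero (suc m))

  tail-fixes-right : ∀ x → swaps (a ∘ suc) (b ∘ suc) x ⟨$⟩ʳ b zero ≡ b zero
  tail-fixes-right x = swaps-fix (a ∘ suc) (b ∘ suc) x (λ m → apart (suc m) zero ∘ sym) (λ m → 0≢1+n ∘ b-injective)

swaps-left : ∀ {n k} {a b : Fin k → Fin n} x → DisjointInjections a b → ∀ m →
             swaps a b x ⟨$⟩ʳ a m ≡ (if x m then b m else a m)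
swaps-left {a = a} {b} x d zero =
  trans (cong (swapIf (x zero) (a zero) (b zero) ⟨$⟩ʳ_) (tail-fixes-left d (x ∘ suc)))
        (swapIf-left (x zero) (a zero) (b zero))
swaps-left {n} {a = a} {b} x d (suc m) = begin
  swap₀ ⟨$⟩ʳ (swaps (a ∘ suc) (b ∘ suc) (x ∘ suc) ⟨$⟩ʳ a (suc m))
    ≡⟨ cong (swap₀ ⟨$⟩ʳ_) (swaps-left (x ∘ suc) (disjoint-tail d) m) ⟩
  swap₀ ⟨$⟩ʳ (if x (suc m) then b (suc m) else a (suc m))
    ≡⟨ if-float (swap₀ ⟨$⟩ʳ_) (x (suc m)) ⟩
  (if x (suc m) then swap₀ ⟨$⟩ʳ b (suc m) else swap₀ ⟨$⟩ʳ a (suc m))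
    ≡⟨ cong₂ (if x (suc m) then_else_) (head-fixes-right d (x zero) m) (head-fixes-left d (x zero) m) ⟩
  (if x (suc m) then b (suc m) else a (suc m)) ∎
  where
  open ≡-Reasoning
  swap₀ : Permutation′ n
  swap₀ = swapIf (x zero) (a zero) (b zero)

swaps-right : ∀ {n k} {a b : Fin k → Fin n} x → DisjointInjections a b → ∀ m →
              swaps a b x ⟨$⟩ʳ b m ≡ (if x m then a m else b m)
swaps-right {a = a} {b} x d zero =
  trans (cong (swapIf (x zero) (a zero) (b zero) ⟨$⟩ʳ_) (tail-fixes-right d (x ∘ suc)))
        (swapIf-right (x zero) (DisjointInjections.apart d zero zero))
swaps-right {n} {a = a} {b} x d (suc m) = begin
  swap₀ ⟨$⟩ʳ (swaps (a ∘ suc) (b ∘ suc) (x ∘ suc) ⟨$⟩ʳ b (suc m))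
    ≡⟨ cong (swap₀ ⟨$⟩ʳ_) (swaps-right (x ∘ suc) (disjoint-tail d) m) ⟩
  swap₀ ⟨$⟩ʳ (if x (suc m) then a (suc m) else b (suc m))
    ≡⟨ if-float (swap₀ ⟨$⟩ʳ_) (x (suc m)) ⟩
  (if x (suc m) then swap₀ ⟨$⟩ʳ a (suc m) else swap₀ ⟨$⟩ʳ b (suc m))
    ≡⟨ cong₂ (if x (suc m) then_else_) (head-fixes-left d (x zero) m) (head-fixes-right d (x zero) m) ⟩
  (if x (suc m) then a (suc m) else b (suc m)) ∎
  where
  open ≡-Reasoning
  swap₀ : Permutation′ n
  swap₀ = swapIf (x zero) (a zero) (b zero)

glue : ∀ {n} → (Var n → Bool) → Assignment n → Assignment n → Assignment n
glue Y p q v = if Y v then p v else q v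

module _ {n s : ℕ} {f : BoolFun n} {Y : Var n → Bool} (cov : RectCover f Y s) where
  open RectCover cov

  rectangle-of : ∀ {p} → f p ≡ true → Σ (Fin s) λ i → r₁ i p ∧ r₂ i p ≡ true
  rectangle-of {p} fp = orFin-elim (trans (sym (covers p)) fp)

  glue-accepted : ∀ {p q} i → r₁ i p ∧ r₂ i p ≡ true → r₁ i q ∧ r₂ i q ≡ true → f (glue Y p q) ≡ true
  glue-accepted {p} {q} i p∈i q∈i = trans (covers _) (orFin-intro i (cong₂ _∧_ r₁-glue r₂-glue))
    where
    r₁-glue : r₁ i (glue Y p q) ≡ true
    r₁-glue = trans (r₁-on-Y i _ p (λ v Yv → cong (λ c → if c then p v else q v) Yv))
                    (∧-conicalˡ _ _ p∈i)
    r₂-glue : r₂ i (glue Y p q) ≡ true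
    r₂-glue = trans (r₂-on-Z i _ q (λ v Zv → cong (λ c → if c then p v else q v) (not-injective {y = false} Zv)))
                    (∧-conicalʳ _ _ q∈i)

funToFin-cong : ∀ {m n} {f g : Fin m → Fin n} → (∀ i → f i ≡ g i) → funToFin f ≡ funToFin g
funToFin-cong {zero}  e = refl
funToFin-cong {suc m} e = cong₂ combine (e zero) (funToFin-cong (e ∘ suc))

cube-injection-bound : ∀ {k s} (g : (Fin k → Bool) → Fin s) →
                       (∀ x y → g x ≡ g y → ∀ m → x m ≡ y m) → 2 ^ k ≤ s
cube-injection-bound {k} g separates = injective⇒≤ {f = g ∘ bits} (bits-injective ∘ separates _ _)
  where
  open ≡-Reasoning
  -- The binary digits of a number below 2^k; injective since funToFin inverts finToFun.
  bits : Fin (2 ^ k) → (Fin k → Bool)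
  bits i = Inverse.to 2↔Bool ∘ finToFun i
  bits-injective : ∀ {i j} → (∀ m → bits i m ≡ bits j m) → i ≡ j
  bits-injective {i} {j} e = begin
    i                             ≡⟨ sym (funToFin-finToFin {k} {2} i) ⟩
    funToFin (finToFun {2} {k} i) ≡⟨ funToFin-cong (Injection.injective (↔⇒↣ 2↔Bool) ∘ e) ⟩
    funToFin (finToFun {2} {k} j) ≡⟨ funToFin-finToFin {k} {2} j ⟩
    j                             ∎

-- If a family of accepted inputs indexed by {0,1}^k is such
-- that gluing A x on Y with A y on Z is rejected whenever x m < y m for some m,
-- then no rectangle contains two members and every cover has size ≥ 2^k.
fooling-set-bound : ∀ {n k s} {f : BoolFun n} {Y : Var n → Bool} (A : (Fin k → Bool) → Assignment n) →
                    (∀ x → f (A x) ≡ true) →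
                    (∀ x y m → x m ≡ false → y m ≡ true → f (glue Y (A x) (A y)) ≢ true) →
                    RectCover f Y s → 2 ^ k ≤ s
fooling-set-bound {k = k} {s} {f} {Y} A accepted fooling cov = cube-injection-bound index separates
  where
  open RectCover cov
  index : (Fin k → Bool) → Fin s
  index x = proj₁ (rectangle-of cov (accepted x))
  same-rectangle : ∀ x y → index x ≡ index y → f (glue Y (A x) (A y)) ≡ true
  same-rectangle x y e =
    glue-accepted cov (index x) (proj₂ (rectangle-of cov (accepted x)))
      (subst (λ i → r₁ i (A y) ∧ r₂ i (A y) ≡ true) (sym e) (proj₂ (rectangle-of cov (accepted y))))
  separates : ∀ x y → index x ≡ index y → ∀ m → x m ≡ y m
  separates x y e m with x m in xm | y m in ym
  ... | false | false = refl
  ... | true  | true  = refl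
  ... | false | true  = contradiction (same-rectangle x y e) (fooling x y m xm ym)
  ... | true  | false = contradiction (same-rectangle y x (sym e)) (fooling y x m ym xm)

record DiagonalSplit {n : ℕ} (Y : Var n → Bool) (k : ℕ) : Set where
  field
    inside            : Fin k → Fin n
    outside           : Fin k → Fin n
    inside-injective  : Injective _≡_ _≡_ inside
    outside-injective : Injective _≡_ _≡_ outside
    inside-in-Y       : ∀ m → Y (inside m , inside m) ≡ true
    outside-not-in-Y  : ∀ m → Y (outside m , outside m) ≡ false

  disjoint : DisjointInjections inside outside
  disjoint = record
    { a-injective = inside-injective
    ; b-injective = outside-injective
    ; apart       = λ m m' e →
        contradiction (trans (sym (inside-in-Y m)) (trans (cong (λ i → Y (i , i)) e) (outside-not-in-Y m'))) λ ()
    }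

module PermFooling {n k : ℕ} {Y : Var n → Bool} (split : DiagonalSplit Y k) where
  open DiagonalSplit split
  open DisjointInjections disjoint using (apart)

  σ : (Fin k → Bool) → Permutation′ n
  σ = swaps inside outside

  A : (Fin k → Bool) → Assignment n
  A x = permMatrix (σ x)

  σ-fixes-inside : ∀ x m → x m ≡ false → σ x ⟨$⟩ʳ inside m ≡ inside m
  σ-fixes-inside x m xm = trans (swaps-left x disjoint m) (cong (λ c → if c then outside m else inside m) xm)

  σ-fixes-outside : ∀ x m → x m ≡ false → σ x ⟨$⟩ʳ outside m ≡ outside m
  σ-fixes-outside x m xm = trans (swaps-right x disjoint m) (cong (λ c → if c then inside m else outside m) xm)

  σ-moves-outside : ∀ y m → y m ≡ true → σ y ⟨$⟩ʳ outside m ≡ inside m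
  σ-moves-outside y m ym = trans (swaps-right y disjoint m) (cong (λ c → if c then inside m else outside m) ym)

  -- Below, a = inside m, b = outside m, x m = 0 and y m = 1, and M glues A x on Y
  -- with A y on Z. If x_ba ∈ Y, row b of M is empty: on Y it agrees with row b
  -- of A x, whose only 1 is at (b, b) ∉ Y, and on Z with row b of A y, whose
  -- only 1 is at (b, a) ∈ Y.
  glued-row-empty : ∀ x y m → x m ≡ false → y m ≡ true → Y (outside m , inside m) ≡ true →
                    ∀ j → glue Y (A x) (A y) (outside m , j) ≡ false
  glued-row-empty x y m xm ym ba∈Y j with Y (outside m , j) in bj∈Y
  ... | true  = trans (cong (λ i → does (i ≟ j)) (σ-fixes-outside x m xm))
                      (dec-false (outside m ≟ j) λ { refl → contradiction (trans (sym bj∈Y) (outside-not-in-Y m)) λ () })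
  ... | false = trans (cong (λ i → does (i ≟ j)) (σ-moves-outside y m ym))
                      (dec-false (inside m ≟ j) λ { refl → contradiction (trans (sym ba∈Y) bj∈Y) λ () })

  -- Otherwise column a of M has a 1 at (a, a) ∈ Y, from A x, and at (b, a) ∉ Y, from A y.
  glued-inside-one : ∀ x y m → x m ≡ false → glue Y (A x) (A y) (inside m , inside m) ≡ true
  glued-inside-one x y m xm = begin
    glue Y (A x) (A y) (a , a)  ≡⟨ cong (λ c → if c then A x (a , a) else A y (a , a)) (inside-in-Y m) ⟩
    does (σ x ⟨$⟩ʳ a ≟ a)       ≡⟨ cong (λ i → does (i ≟ a)) (σ-fixes-inside x m xm) ⟩
    does (a ≟ a)                ≡⟨ dec-true (a ≟ a) refl ⟩
    true                        ∎
    where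
    open ≡-Reasoning
    a : Fin n
    a = inside m

  glued-outside-one : ∀ x y m → y m ≡ true → Y (outside m , inside m) ≡ false →
                      glue Y (A x) (A y) (outside m , inside m) ≡ true
  glued-outside-one x y m ym ba∉Y = begin
    glue Y (A x) (A y) (b , a)  ≡⟨ cong (λ c → if c then A x (b , a) else A y (b , a)) ba∉Y ⟩
    does (σ y ⟨$⟩ʳ b ≟ a)       ≡⟨ cong (λ i → does (i ≟ a)) (σ-moves-outside y m ym) ⟩
    does (a ≟ a)                ≡⟨ dec-true (a ≟ a) refl ⟩
    true                        ∎
    where
    open ≡-Reasoning
    a b : Fin n
    a = inside m
    b = outside m

  glued-not-perm : ∀ x y m → x m ≡ false → y m ≡ true → ¬ IsPermMatrix (glue Y (A x) (A y))
  glued-not-perm x y m xm ym M-perm with Y (outside m , inside m) in ba∈Y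
  ... | true  = contradiction (trans (sym (countTrue-none (glued-row-empty x y m xm ym ba∈Y)))
                                     (IsPermMatrix.rows M-perm (outside m))) λ ()
  ... | false = apart m m (countTrue≡1-unique (IsPermMatrix.columns M-perm (inside m))
                                              (glued-inside-one x y m xm) (glued-outside-one x y m ym ba∈Y))

  perm-cover-bound : ∀ {s} → RectCover (PERM n) Y s → 2 ^ k ≤ s
  perm-cover-bound = fooling-set-bound A (λ x → PERM-intro (permMatrix-isPerm (σ x)))
                       (λ x y m xm ym → glued-not-perm x y m xm ym ∘ PERM-elim)

select : ∀ {n} k (P : Fin n → Bool) → k ≤ countTrue P →
         Σ (Fin k → Fin n) λ e → Injective _≡_ _≡_ e × (∀ m → P (e m) ≡ true)
select zero P _ = (λ ()) , (λ { {()} }) , (λ ())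
select {suc n} (suc k) P k<count with P zero in P0
... | true  = let (e , e-injective , e-sound) = select k (P ∘ suc) (s≤s⁻¹ k<count)
              in cons e , cons-injective e-injective , cons-sound e-sound
  where
  cons : (Fin k → Fin n) → Fin (suc k) → Fin (suc n)
  cons e zero    = zero
  cons e (suc m) = suc (e m)
  cons-injective : ∀ {e} → Injective _≡_ _≡_ e → Injective _≡_ _≡_ (cons e)
  cons-injective inj {zero}  {zero}  _ = refl
  cons-injective inj {suc m} {suc m'} eq = cong suc (inj (suc-injective eq))
  cons-sound : ∀ {e} → (∀ m → P (suc (e m)) ≡ true) → ∀ m → P (cons e m) ≡ true
  cons-sound sound zero    = P0
  cons-sound sound (suc m) = sound m
... | false = let (e , e-injective , e-sound) = select (suc k) (P ∘ suc) k<count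
              in suc ∘ e , e-injective ∘ suc-injective , e-sound

complement-large : ∀ {a b n} k → a + b ≡ n → a ≤ k + k → 3 * k ≤ n → k ≤ b
complement-large {a} {b} {n} k a+b≡n a≤2k 3k≤n = +-cancelˡ-≤ (k + k) k b (begin
  k + k + k     ≡⟨ +-assoc k k k ⟩
  k + (k + k)   ≡⟨ cong (λ z → k + (k + z)) (sym (+-identityʳ k)) ⟩
  3 * k         ≤⟨ 3k≤n ⟩
  n             ≡⟨ sym a+b≡n ⟩
  a + b         ≤⟨ +-monoˡ-≤ b a≤2k ⟩
  k + k + b     ∎)
  where open ≤-Reasoning

diagonal-split : ∀ {n} k (t : Tree n) → 3 * k ≤ n → k ≤ diagCount t → diagCount t ≤ k + k →
                 DiagonalSplit (var t) k
diagonal-split k t 3k≤n k≤inside inside≤2k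
  with select k (diagonal (var t)) k≤inside
     | select k (not ∘ diagonal (var t))
         (complement-large k (countTrue-compl (diagonal (var t))) inside≤2k 3k≤n)
... | a , a-injective , a-inside | b , b-injective , b-outside = record
  { inside            = a
  ; outside           = b
  ; inside-injective  = a-injective
  ; outside-injective = b-injective
  ; inside-in-Y       = a-inside
  ; outside-not-in-Y  = λ m → not-injective {y = false} (b-outside m)
  }

-- When 3k ≤ n, every v-tree has a node splitting the diagonal k / k: a
-- balanced node for diagCount, which is n at the root.
balanced-split : ∀ {n} k → 1 ≤ k → 3 * k ≤ n → (T : VTree n) →
                 Σ (Tree n) λ t → t ≼ tree T × DiagonalSplit (var t) k
balanced-split k 1≤k 3k≤n T =
  let (t , t≼T , k≤inside , inside≤2k) = balanced-node k 1≤k (tree T) k≤root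
  in t , t≼T , diagonal-split k t 3k≤n k≤inside inside≤2k
  where
  open BalancedNode diagCount diagCount-leaf diagCount-node
  k≤root : k ≤ diagCount (tree T)
  k≤root = ≤-trans (m≤m+n k _) (≤-trans 3k≤n (≤-reflexive (sym (diagCount-root T))))

third-large : ∀ {n} → 6 ≤ n → 2 ≤ n / 3
third-large 6≤n = /-monoˡ-≤ 3 6≤n

thrice-third≤ : ∀ n → 3 * (n / 3) ≤ n
thrice-third≤ n = ≤-trans (≤-reflexive (*-comm 3 (n / 3))) (m/n*n≤m n 3)

≤four-thirds : ∀ {n} → 6 ≤ n → n ≤ n / 3 * 4
≤four-thirds {n} 6≤n = begin
  n                   ≡⟨ m≡m%n+[m/n]*n n 3 ⟩
  n % 3 + n / 3 * 3   ≤⟨ +-monoˡ-≤ (n / 3 * 3) (≤-trans (s≤s⁻¹ (m%n<n n 3)) (third-large 6≤n)) ⟩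
  n / 3 + n / 3 * 3   ≡⟨ sym (*-suc (n / 3) 3) ⟩
  n / 3 * 4           ∎
  where open ≤-Reasoning

-- The theorem, with c = 1/4 and n₀ = 6: at a node t splitting the diagonal
-- ⌊n/3⌋ / ⌊n/3⌋, every cover has size s ≥ 2^⌊n/3⌋, so s⁴ ≥ 2^n.
lemma8 : Σ ℕ λ p → Σ ℕ λ q → Σ ℕ λ n₀ → 0 < p × 0 < q ×
    (∀ (n : ℕ) → n₀ ≤ n → (T : VTree n) →
    Σ (Tree n) λ t → t ≼ tree T ×
    (∀ (s : ℕ) → RectCover (PERM n) (var t) s → 2 ^ (p * n) ≤ s ^ q))
lemma8 = 1 , 4 , 6 , s≤s z≤n , s≤s z≤n , linear-node
  where
  linear-node : ∀ n → 6 ≤ n → (T : VTree n) →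
                Σ (Tree n) λ t → t ≼ tree T × (∀ s → RectCover (PERM n) (var t) s → 2 ^ (1 * n) ≤ s ^ 4)
  linear-node n 6≤n T =
    let (t , t≼T , split) = balanced-split (n / 3) (≤-trans (s≤s z≤n) (third-large 6≤n)) (thrice-third≤ n) T
    in t , t≼T , λ s cov → begin
      2 ^ (1 * n)        ≡⟨ cong (2 ^_) (*-identityˡ n) ⟩
      2 ^ n              ≤⟨ ^-monoʳ-≤ 2 (≤four-thirds 6≤n) ⟩
      2 ^ (n / 3 * 4)    ≡⟨ sym (^-*-assoc 2 (n / 3) 4) ⟩
      (2 ^ (n / 3)) ^ 4  ≤⟨ ^-monoˡ-≤ 4 (PermFooling.perm-cover-bound split cov) ⟩
      s ^ 4              ∎
    where open ≤-Reasoning
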